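{- The axiomatization $\mathbf{OML}$ is complete for $\mathcal{L}^{\Box\circ}$: every valid formula of $\mathcal{L}^{\Box\circ}$ is derivable in $\mathbf{OML}$.
   Context: Fix a non-empty countable set $P$ of atoms and a non-empty finite set $A$ of agents. $\mathcal{L}^{\Box\circ}$: $\varphi ::= p \mid \neg\varphi \mid (\varphi\wedge\varphi) \mid \Box_a\varphi \mid [\circ]\varphi$; $\mathcal{L}_0$ is the propositional fragment. Abbreviations: Boolean connectives, $\Diamond_a\varphi:=\neg\Box_a\neg\varphi$. A model is $M=(S,R,V)$ with $S$ non-empty countable, $R_a\subseteq S\times S$, $V:S\to\mathcal{P}(P)$. The mutual factual ignorance model is $M^\circ=(S^\circ,R^\circ,V^\circ)$ with $S^\circ=\mathcal{P}(P)$, $R^\circ_a=S^\circ\times S^\circ$ for all $a$, $V^\circ(s)=s$. Semantics: $M_s\models p$ iff $p\in V(s)$; Boolean clauses as usual; $M_s\models\Box_a\varphi$ iff $M_t\models\varphi$ for all $(s,t)\in R_a$; $M_s\models[\circ]\varphi$ iff $M^\circ_{V(s)}\models\varphi$. Valid: true at every pointed model (with countable domain). $\mathbf{OML}$ over $\mathcal{L}^{\Box\circ}$: Prop; K: $\Box_a(\varphi\to\psi)\to(\Box_a\varphi\to\Box_a\psi)$; MP; N: from $\varphi$ infer $\Box_a\varphi$; RE: from $\chi\leftrightarrow\psi$ infer $\varphi[\chi/p]\leftrightarrow\varphi[\psi/p]$; O1: $[\circ]\varphi_0\leftrightarrow\varphi_0$ ($\varphi_0\in\mathcal{L}_0$);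 OT: $[\circ](\Box_a\varphi\to\varphi)$; O5: $[\circ](\Diamond_a\varphi\to\Box_a\Diamond_a\varphi)$; OExch: $[\circ](\Box_a\varphi\to\Box_b\varphi)$; OFull: $[\circ]\Diamond_a(\bigwedge_{p\in Q_1}p\wedge\bigwedge_{p\in Q_2}\neg p)$ for finite $Q_1,Q_2\subseteq P$ with $Q_1\cap Q_2=\emptyset$; ODual: $[\circ]\neg\varphi\leftrightarrow\neg[\circ]\varphi$; ODisj: $[\circ](\varphi\vee\psi)\leftrightarrow([\circ]\varphi\vee[\circ]\psi)$; OMP: from $[\circ](\varphi\to\psi)$ and $[\circ]\varphi$ infer $[\circ]\psi$; ON: from $[\circ]\varphi$ infer $[\circ]\Box_a\varphi$. -}

module Defs where

open import Data.Nat using (ℕ)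
open import Data.Nat.Properties using () renaming (_≟_ to _≟ℕ_)
open import Data.Fin using (Fin)
open import Data.Bool using (Bool; true; false; not; _∧_)
open import Data.List using (List; []; _∷_)
open import Data.List.Membership.Propositional using (_∈_; _∉_)
open import Data.Product using (Σ; ∃; _×_; _,_)
open import Data.Unit using (⊤)
open import Data.Empty using (⊥)
open import Relation.Nullary using (¬_; Dec; yes; no)
open import Relation.Binary.PropositionalEquality using (_≡_; refl; cong)
open import Relation.Binary.Definitions using (DecidableEquality)
open import Function.Definitions using (Injective)

-- Decidable equality of atoms from an injection into ℕ (countability of P).
decFromInj : {P : Set} (enc : P → ℕ) → Injective _≡_ _≡_ enc → DecidableEquality P
decFromInj enc inj p q with enc p ≟ℕ enc q
... | yes e = yes (inj e)
... | no ne = no (λ e → ne (cong enc e))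

-- Propositional formulas over ℕ-indexed variables (schemes for axiom Prop).
data PForm : Set where
  var  : ℕ → PForm
  pneg : PForm → PForm
  pand : PForm → PForm → PForm

peval : (ℕ → Bool) → PForm → Bool
peval v (var i) = v i
peval v (pneg f) = not (peval v f)
peval v (pand f g) = peval v f ∧ peval v g

Tautology : PForm → Set
Tautology f = ∀ (v : ℕ → Bool) → peval v f ≡ true

-- The logic, parameterised by the atom set P (with decidable equality and a
-- distinguished atom p₀, witnessing non-emptiness) and the number of agents nA.
module Logic (P : Set) (_≟_ : DecidableEquality P) (p₀ : P) (nA : ℕ) where

  Agent : Set
  Agent = Fin nA

  data Form : Set where
    atom : P → Form
    ¬'_  : Form → Form
    _∧'_ : Form → Form → Form
    □    : Agent → Form → Form
    [∘]  : Form → Form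

  infixr 6 _∧'_
  infixr 5 _∨'_
  infixr 4 _⇒_
  infix 3 _⇔_

  _∨'_ : Form → Form → Form
  φ ∨' ψ = ¬' (¬' φ ∧' ¬' ψ)

  _⇒_ : Form → Form → Form
  φ ⇒ ψ = ¬' (φ ∧' ¬' ψ)

  _⇔_ : Form → Form → Form
  φ ⇔ ψ = (φ ⇒ ψ) ∧' (ψ ⇒ φ)

  ◇ : Agent → Form → Form
  ◇ a φ = ¬' □ a (¬' φ)

  ⊤' : Form
  ⊤' = ¬' (atom p₀ ∧' ¬' atom p₀)

  ⋀ : List Form → Form
  ⋀ [] = ⊤'
  ⋀ (φ ∷ φs) = φ ∧' ⋀ φs

  mapL : {X Y : Set} → (X → Y) → List X → List Y
  mapL f [] = []
  mapL f (x ∷ xs) = f x ∷ mapL f xs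

  IsL0 : Form → Set
  IsL0 (atom p) = ⊤
  IsL0 (¬' φ) = IsL0 φ
  IsL0 (φ ∧' ψ) = IsL0 φ × IsL0 ψ
  IsL0 (□ a φ) = ⊥
  IsL0 ([∘] φ) = ⊥

  inst : (ℕ → Form) → PForm → Form
  inst σ (var i) = σ i
  inst σ (pneg f) = ¬' inst σ f
  inst σ (pand f g) = inst σ f ∧' inst σ g

  _[_/_] : Form → Form → P → Form
  atom q [ χ / p ] with q ≟ p
  ... | yes _ = χ
  ... | no _ = atom q
  (¬' φ) [ χ / p ] = ¬' (φ [ χ / p ])
  (φ ∧' ψ) [ χ / p ] = (φ [ χ / p ]) ∧' (ψ [ χ / p ])
  □ a φ [ χ / p ] = □ a (φ [ χ / p ])
  [∘] φ [ χ / p ] = [∘] (φ [ χ / p ])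

  data ⊢_ : Form → Set where
    Prop  : ∀ (f : PForm) (σ : ℕ → Form) → Tautology f → ⊢ inst σ f
    K     : ∀ a φ ψ → ⊢ (□ a (φ ⇒ ψ) ⇒ (□ a φ ⇒ □ a ψ))
    MP    : ∀ {φ ψ} → ⊢ (φ ⇒ ψ) → ⊢ φ → ⊢ ψ
    N     : ∀ a {φ} → ⊢ φ → ⊢ □ a φ
    RE    : ∀ {χ ψ} (φ : Form) (p : P) → ⊢ (χ ⇔ ψ) → ⊢ ((φ [ χ / p ]) ⇔ (φ [ ψ / p ]))
    O1    : ∀ φ₀ → IsL0 φ₀ → ⊢ ([∘] φ₀ ⇔ φ₀)
    OT    : ∀ a φ → ⊢ [∘] (□ a φ ⇒ φ)
    O5    : ∀ a φ → ⊢ [∘] (◇ a φ ⇒ □ a (◇ a φ))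
    OExch : ∀ a b φ → ⊢ [∘] (□ a φ ⇒ □ b φ)
    OFull : ∀ a (Q₁ Q₂ : List P) → (∀ p → p ∈ Q₁ → p ∉ Q₂) →
            ⊢ [∘] (◇ a (⋀ (mapL atom Q₁) ∧' ⋀ (mapL (λ p → ¬' atom p) Q₂)))
    ODual : ∀ φ → ⊢ ([∘] (¬' φ) ⇔ ¬' [∘] φ)
    ODisj : ∀ φ ψ → ⊢ ([∘] (φ ∨' ψ) ⇔ ([∘] φ ∨' [∘] ψ))
    OMP   : ∀ {φ ψ} → ⊢ [∘] (φ ⇒ ψ) → ⊢ [∘] φ → ⊢ [∘] ψ
    ON    : ∀ a {φ} → ⊢ [∘] φ → ⊢ [∘] (□ a φ)

  -- Kripke models; subsets of P are represented as characteristic functions P → Bool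
  record Model : Set₁ where
    field
      S : Set
      R : Agent → S → S → Set
      V : S → P → Bool

  open Model public

  M∘ : Model
  M∘ = record { S = P → Bool ; R = λ _ _ _ → ⊤ ; V = λ s → s }

  _,_⊨_ : (M : Model) → S M → Form → Set
  M , s ⊨ atom p = V M s p ≡ true
  M , s ⊨ (¬' φ) = ¬ (M , s ⊨ φ)
  M , s ⊨ (φ ∧' ψ) = (M , s ⊨ φ) × (M , s ⊨ ψ)
  M , s ⊨ □ a φ = ∀ t → R M a s t → M , t ⊨ φ
  M , s ⊨ [∘] φ = M∘ , V M s ⊨ φ

  CountableNonEmpty : Set → Set
  CountableNonEmpty X = Σ (ℕ → X) (λ f → ∀ x → ∃ (λ n → f n ≡ x))

  Valid : Form → Set₁
  Valid φ = ∀ (M : Model) → CountableNonEmpty (S M) → ∀ (s : S M) → M , s ⊨ φ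

{-# OPTIONS --safe #-}

-- In the ignorance model M∘ every relation is total, so each □ₐ φ has the same truth value
-- at all states of M∘. By induction, [∘] φ is therefore provably equivalent to a propositional
-- formula (O1, ODual and ODisj for the Boolean structure; ON and OFull for the boxes).
-- Replacing every [∘]-subformula accordingly reduces the theorem to completeness of multi-agent K,
-- which is proved constructively by a tableau procedure returning either a derivation or a
-- countermodel with an enumerable carrier.

module Submission where

open import Defs
open import Data.Bool using (Bool; true; false; not; _∧_; T)
open import Data.Bool.Properties using (T-∧; T-≡) renaming (_≟_ to _≟ᵇ_)
open import Data.Empty using (⊥; ⊥-elim)
open import Data.Fin.Properties using () renaming (_≟_ to _≟ᴬ_)
open import Data.List using (List; []; _∷_; map; _++_; filter)
open import Data.List.Membership.Propositional using (_∈_; _∉_; find; lose)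
open import Data.List.Membership.Propositional.Properties using (∈-map⁺; ∈-filter⁺; ∈-filter⁻; ∈-++⁺ˡ; ∈-++⁺ʳ)
open import Data.List.Relation.Binary.Subset.Propositional using (_⊆_)
open import Data.List.Relation.Unary.All using (All; []; _∷_)
import Data.List.Relation.Unary.All as All
open import Data.List.Relation.Unary.Any using (Any; here; there; any?)
open import Data.Maybe using (Maybe; just; nothing; fromMaybe)
import Data.Maybe as Maybe
open import Data.Nat using (ℕ; zero; suc; _+_; _⊔_; _≤_; z≤n; s≤s; s≤s⁻¹; _<ᵇ_)
open import Data.Nat.Properties using (m⊔n≤o⇒m≤o; m⊔n≤o⇒n≤o; ≤-refl)
open import Data.Product using (Σ; ∃; _×_; _,_; proj₁; proj₂)
open import Data.Product.Function.NonDependent.Propositional using (_×-⇔_)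
open import Data.Sum using (_⊎_; inj₁; inj₂; [_,_])
import Data.Sum as Sum
open import Data.Unit using (⊤; tt)
open import Data.Vec using (Vec; []; _∷_)
open import Function using (_∘_; id)
open import Function.Bundles using (Equivalence; mk⇔) renaming (_⇔_ to _⟺_)
open import Function.Construct.Composition using (_⇔-∘_)
open import Function.Construct.Symmetry using () renaming (⇔-sym to ⟺-sym)
open import Function.Definitions using (Injective)
open import Function.Related.TypeIsomorphisms using (¬-cong-⇔)
open import Level using (Lift; lift)
open import Relation.Binary.Definitions using (DecidableEquality)
open import Relation.Binary.PropositionalEquality using (_≡_; _≢_; refl; sym; cong; cong₂; trans; subst; subst₂)
import Relation.Binary.Reasoning.Base.Single as Reasoning
open import Relation.Nullary using (¬_; Dec; yes; no; does)
open import Relation.Nullary.Decidable using (dec-true; ¬?; _×-dec_)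

open Equivalence using (to; from)

infix 7 ¬ₚ_
infixr 6 _∧ₚ_
infixr 4 _⇒ₚ_
infix 3 _⇔ₚ_

¬ₚ_ : PForm → PForm
¬ₚ_ = pneg

_∧ₚ_ _⇒ₚ_ _⇔ₚ_ : PForm → PForm → PForm
f ∧ₚ g = pand f g
f ⇒ₚ g = ¬ₚ (f ∧ₚ ¬ₚ g)
f ⇔ₚ g = (f ⇒ₚ g) ∧ₚ (g ⇒ₚ f)

x₀ x₁ x₂ x₃ ⊤ₚ : PForm
x₀ = var 0
x₁ = var 1
x₂ = var 2
x₃ = var 3
-- Instantiated with x₀ := atom p₀ this is ⊤'.
⊤ₚ = ¬ₚ (x₀ ∧ₚ ¬ₚ x₀)

lookupOr : {A : Set} {n : ℕ} → A → Vec A n → ℕ → A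
lookupOr d []       i       = d
lookupOr d (x ∷ xs) zero    = x
lookupOr d (x ∷ xs) (suc i) = lookupOr d xs i

varsBelow : ℕ → PForm → Bool
varsBelow n (var i)    = i <ᵇ n
varsBelow n (pneg f)   = varsBelow n f
varsBelow n (pand f g) = varsBelow n f ∧ varsBelow n g

everyRow : (n : ℕ) → (Vec Bool n → Bool) → Bool
everyRow zero    g = g []
everyRow (suc n) g = everyRow n (g ∘ (true ∷_)) ∧ everyRow n (g ∘ (false ∷_))

everyRow-sound : ∀ n g → T (everyRow n g) → ∀ v → T (g v)
everyRow-sound zero    g h []          = h
everyRow-sound (suc n) g h (true ∷ v)  = everyRow-sound n _ (proj₁ (to T-∧ h)) v
everyRow-sound (suc n) g h (false ∷ v) = everyRow-sound n _ (proj₂ (to (T-∧ {everyRow n _}) h)) v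

isTautologyOver : ℕ → PForm → Bool
isTautologyOver n f = varsBelow n f ∧ everyRow n (λ v → peval (lookupOr false v) f)

prefix : (n : ℕ) → (ℕ → Bool) → Vec Bool n
prefix zero    v = []
prefix (suc n) v = v 0 ∷ prefix n (v ∘ suc)

lookupOr-prefix : ∀ n v i → T (i <ᵇ n) → lookupOr false (prefix n v) i ≡ v i
lookupOr-prefix (suc n) v zero    _ = refl
lookupOr-prefix (suc n) v (suc i) h = lookupOr-prefix n (v ∘ suc) i h

peval-prefix : ∀ n v f → T (varsBelow n f) → peval (lookupOr false (prefix n v)) f ≡ peval v f
peval-prefix n v (var i)    h = lookupOr-prefix n v i h
peval-prefix n v (pneg f)   h = cong not (peval-prefix n v f h)
peval-prefix n v (pand f g) h = cong₂ _∧_ (peval-prefix n v f h₁) (peval-prefix n v g h₂)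
  where h₁ = proj₁ (to T-∧ h); h₂ = proj₂ (to (T-∧ {varsBelow n f}) h)

truthTable-sound : ∀ n f → T (isTautologyOver n f) → Tautology f
truthTable-sound n f h v = trans (sym (peval-prefix n v f vars)) (to T-≡ rows)
  where
  vars = proj₁ (to T-∧ h)
  rows = everyRow-sound n _ (proj₂ (to (T-∧ {varsBelow n f}) h)) (prefix n v)

-- Enumerations may skip indices, so that ⊥ and finite sums are covered.
Enumerable : Set → Set
Enumerable X = Σ (ℕ → Maybe X) λ e → ∀ x → ∃ λ n → e n ≡ just x

Enumerable-⊥ : Enumerable ⊥
Enumerable-⊥ = (λ _ → nothing) , λ ()

Enumerable-Maybe : {X : Set} → Enumerable X → Enumerable (Maybe X)
Enumerable-Maybe {X} (e , e-onto) = e′ , e′-onto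
  where
  e′ : ℕ → Maybe (Maybe X)
  e′ zero    = just nothing
  e′ (suc n) = Maybe.map just (e n)
  e′-onto : ∀ x → ∃ λ n → e′ n ≡ just x
  e′-onto nothing  = zero , refl
  e′-onto (just x) = let n , eₙ = e-onto x in suc n , cong (Maybe.map just) eₙ

halve : ℕ → ℕ ⊎ ℕ
halve zero          = inj₁ zero
halve (suc zero)    = inj₂ zero
halve (suc (suc n)) = Sum.map suc suc (halve n)

halve-onto : ∀ x → ∃ λ n → halve n ≡ x
halve-onto (inj₁ zero)    = 0 , refl
halve-onto (inj₂ zero)    = 1 , refl
halve-onto (inj₁ (suc i)) = let n , hₙ = halve-onto (inj₁ i) in 2 + n , cong (Sum.map suc suc) hₙ
halve-onto (inj₂ (suc j)) = let n , hₙ = halve-onto (inj₂ j) in 2 + n , cong (Sum.map suc suc) hₙ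

Enumerable-⊎ : {X Y : Set} → Enumerable X → Enumerable Y → Enumerable (X ⊎ Y)
Enumerable-⊎ {X} {Y} (e₁ , e₁-onto) (e₂ , e₂-onto) = e , e-onto
  where
  pick : ℕ ⊎ ℕ → Maybe (X ⊎ Y)
  pick = [ Maybe.map inj₁ ∘ e₁ , Maybe.map inj₂ ∘ e₂ ]
  e : ℕ → Maybe (X ⊎ Y)
  e = pick ∘ halve
  e-onto : ∀ z → ∃ λ n → e n ≡ just z
  e-onto (inj₁ x) = let i , eᵢ = e₁-onto x ; n , hₙ = halve-onto (inj₁ i)
                    in n , trans (cong pick hₙ) (cong (Maybe.map inj₁) eᵢ)
  e-onto (inj₂ y) = let j , eⱼ = e₂-onto y ; n , hₙ = halve-onto (inj₂ j)
                    in n , trans (cong pick hₙ) (cong (Maybe.map inj₂) eⱼ)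

module Completeness (P : Set) (_≟_ : DecidableEquality P) (p₀ : P) (nA : ℕ) where
  open Logic P _≟_ p₀ nA
  open import Data.List.Membership.DecPropositional _≟_ using (_∈?_)

  private variable
    A B C D : Form

  -- Derived rules of OML

  taut : ∀ {n} (f : PForm) (ρ : Vec Form n) {_ : T (isTautologyOver n f)} → ⊢ inst (lookupOr ⊤' ρ) f
  taut {n} f ρ {h} = Prop f _ (truthTable-sound n f h)

  MP₂ : ⊢ (A ⇒ B ⇒ C) → ⊢ A → ⊢ B → ⊢ C
  MP₂ h a b = MP (MP h a) b

  ⊢⊤ : ⊢ ⊤'
  ⊢⊤ = taut ⊤ₚ (atom p₀ ∷ [])

  ⇒-trans : ⊢ (A ⇒ B) → ⊢ (B ⇒ C) → ⊢ (A ⇒ C)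
  ⇒-trans {A} {B} {C} = MP₂ (taut ((x₀ ⇒ₚ x₁) ⇒ₚ (x₁ ⇒ₚ x₂) ⇒ₚ x₀ ⇒ₚ x₂) (A ∷ B ∷ C ∷ []))

  ⇔-to : ⊢ (A ⇔ B) → ⊢ (A ⇒ B)
  ⇔-to {A} {B} = MP (taut ((x₀ ⇔ₚ x₁) ⇒ₚ x₀ ⇒ₚ x₁) (A ∷ B ∷ []))

  ⇔-from : ⊢ (A ⇔ B) → ⊢ (B ⇒ A)
  ⇔-from {A} {B} = MP (taut ((x₀ ⇔ₚ x₁) ⇒ₚ x₁ ⇒ₚ x₀) (A ∷ B ∷ []))

  ⇔-refl : ⊢ (A ⇔ A)
  ⇔-refl {A} = taut (x₀ ⇔ₚ x₀) (A ∷ [])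

  ⇔-trans : ⊢ (A ⇔ B) → ⊢ (B ⇔ C) → ⊢ (A ⇔ C)
  ⇔-trans {A} {B} {C} = MP₂ (taut ((x₀ ⇔ₚ x₁) ⇒ₚ (x₁ ⇔ₚ x₂) ⇒ₚ (x₀ ⇔ₚ x₂)) (A ∷ B ∷ C ∷ []))

  ¬-cong : ⊢ (A ⇔ B) → ⊢ (¬' A ⇔ ¬' B)
  ¬-cong {A} {B} = MP (taut ((x₀ ⇔ₚ x₁) ⇒ₚ (¬ₚ x₀ ⇔ₚ ¬ₚ x₁)) (A ∷ B ∷ []))

  ∧-cong : ⊢ (A ⇔ B) → ⊢ (C ⇔ D) → ⊢ (A ∧' C ⇔ B ∧' D)
  ∧-cong {A} {B} {C} {D} = MP₂ (taut ((x₀ ⇔ₚ x₁) ⇒ₚ (x₂ ⇔ₚ x₃) ⇒ₚ (x₀ ∧ₚ x₂ ⇔ₚ x₁ ∧ₚ x₃)) (A ∷ B ∷ C ∷ D ∷ []))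

  ∨-cong : ⊢ (A ⇔ B) → ⊢ (C ⇔ D) → ⊢ (A ∨' C ⇔ B ∨' D)
  ∨-cong e₁ e₂ = ¬-cong (∧-cong (¬-cong e₁) (¬-cong e₂))

  module ⇔-Reasoning = Reasoning (λ A B → ⊢ (A ⇔ B)) ⇔-refl ⇔-trans

  sub-self : ∀ χ → atom p₀ [ χ / p₀ ] ≡ χ
  sub-self χ with p₀ ≟ p₀
  ... | yes _ = refl
  ... | no p₀≢p₀ = ⊥-elim (p₀≢p₀ refl)

  □-cong : ∀ a {A B} → ⊢ (A ⇔ B) → ⊢ (□ a A ⇔ □ a B)
  □-cong a {A} {B} e = subst₂ (λ X Y → ⊢ (□ a X ⇔ □ a Y)) (sub-self A) (sub-self B) (RE (□ a (atom p₀)) p₀ e)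

  [∘]-cong : ⊢ (A ⇔ B) → ⊢ ([∘] A ⇔ [∘] B)
  [∘]-cong {A} {B} e = subst₂ (λ X Y → ⊢ ([∘] X ⇔ [∘] Y)) (sub-self A) (sub-self B) (RE ([∘] (atom p₀)) p₀ e)

  [∘]-nec : ⊢ A → ⊢ [∘] A
  [∘]-nec {A} ⊢A = MP (⇔-from ([∘]-cong A⇔⊤)) (MP (⇔-from (O1 ⊤' (_ , _))) ⊢⊤)
    where
    A⇔⊤ : ⊢ (A ⇔ ⊤')
    A⇔⊤ = MP₂ (taut (x₀ ⇒ₚ x₁ ⇒ₚ (x₀ ⇔ₚ x₁)) (A ∷ ⊤' ∷ [])) ⊢A ⊢⊤

  [∘]-∧ : ∀ A B → ⊢ ([∘] (A ∧' B) ⇔ [∘] A ∧' [∘] B)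
  [∘]-∧ A B = begin
    [∘] (A ∧' B)                   ∼⟨ [∘]-cong (taut (x₀ ∧ₚ x₁ ⇔ₚ ¬ₚ ¬ₚ (¬ₚ ¬ₚ x₀ ∧ₚ ¬ₚ ¬ₚ x₁)) (A ∷ B ∷ [])) ⟩
    [∘] (¬' (¬' A ∨' ¬' B))        ∼⟨ ODual _ ⟩
    ¬' [∘] (¬' A ∨' ¬' B)          ∼⟨ ¬-cong (ODisj _ _) ⟩
    ¬' ([∘] (¬' A) ∨' [∘] (¬' B))  ∼⟨ ¬-cong (∨-cong (ODual A) (ODual B)) ⟩
    ¬' (¬' [∘] A ∨' ¬' [∘] B)      ∼⟨ taut (¬ₚ ¬ₚ (¬ₚ ¬ₚ x₀ ∧ₚ ¬ₚ ¬ₚ x₁) ⇔ₚ x₀ ∧ₚ x₁) ([∘] A ∷ [∘] B ∷ []) ⟩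
    [∘] A ∧' [∘] B                 ∎
    where open ⇔-Reasoning

  [∘]-⇒ : ∀ A B → ⊢ ([∘] (A ⇒ B) ⇔ ([∘] A ⇒ [∘] B))
  [∘]-⇒ A B = begin
    [∘] (A ⇒ B)               ∼⟨ ODual _ ⟩
    ¬' [∘] (A ∧' ¬' B)        ∼⟨ ¬-cong ([∘]-∧ A (¬' B)) ⟩
    ¬' ([∘] A ∧' [∘] (¬' B))  ∼⟨ ¬-cong (∧-cong ⇔-refl (ODual B)) ⟩
    ([∘] A ⇒ [∘] B)           ∎
    where open ⇔-Reasoning

  □-mono : ∀ a {A B} → ⊢ (A ⇒ B) → ⊢ (□ a A ⇒ □ a B)
  □-mono a {A} {B} h = MP (K a A B) (N a h)

  □-mono₂ : ∀ a {A B C} → ⊢ (A ⇒ B ⇒ C) → ⊢ (□ a A ⇒ □ a B ⇒ □ a C)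
  □-mono₂ a {A} {B} {C} h = ⇒-trans (□-mono a h) (K a B C)

  ∧-⇒ˡ : ∀ B → ⊢ (A ⇒ C) → ⊢ (A ∧' B ⇒ C)
  ∧-⇒ˡ {A} B = ⇒-trans (taut (x₀ ∧ₚ x₁ ⇒ₚ x₀) (A ∷ B ∷ []))

  ∧-⇒ʳ : ∀ A → ⊢ (B ⇒ C) → ⊢ (A ∧' B ⇒ C)
  ∧-⇒ʳ {B} A = ⇒-trans (taut (x₀ ∧ₚ x₁ ⇒ₚ x₁) (A ∷ B ∷ []))

  ⋀-∈ : ∀ {φ Φ} → φ ∈ Φ → ⊢ (⋀ Φ ⇒ φ)
  ⋀-∈ {φ} {.φ ∷ Φ} (here refl) = taut (x₀ ∧ₚ x₁ ⇒ₚ x₀) (φ ∷ ⋀ Φ ∷ [])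
  ⋀-∈ {φ} {ψ ∷ Φ}  (there φ∈Φ) = ∧-⇒ʳ ψ (⋀-∈ φ∈Φ)

  ⊢¬∧ : ∀ {A B} C → ⊢ (A ⇒ B) → ⊢ (A ⇒ ¬' B) → ⊢ ¬' (A ∧' C)
  ⊢¬∧ {A} {B} C = MP₂ (taut ((x₀ ⇒ₚ x₁) ⇒ₚ (x₀ ⇒ₚ ¬ₚ x₁) ⇒ₚ ¬ₚ (x₀ ∧ₚ x₂)) (A ∷ B ∷ C ∷ []))

  -- Multi-agent K: formulas, bounded morphisms and tree models

  data KForm : Set where
    katom : P → KForm
    kneg  : KForm → KForm
    kand  : KForm → KForm → KForm
    kbox  : Agent → KForm → KForm

  ⌜_⌝ : KForm → Form
  ⌜ katom p ⌝  = atom p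
  ⌜ kneg φ ⌝   = ¬' ⌜ φ ⌝
  ⌜ kand φ ψ ⌝ = ⌜ φ ⌝ ∧' ⌜ ψ ⌝
  ⌜ kbox a φ ⌝ = □ a ⌜ φ ⌝

  depth : KForm → ℕ
  depth (katom p)  = 0
  depth (kneg φ)   = depth φ
  depth (kand φ ψ) = depth φ ⊔ depth ψ
  depth (kbox a φ) = suc (depth φ)

  ⊨-stable : ∀ (M : Model) s φ → ¬ ¬ (M , s ⊨ ⌜ φ ⌝) → M , s ⊨ ⌜ φ ⌝
  ⊨-stable M s (katom p)  ¬¬φ with V M s p
  ... | true  = refl
  ... | false = ⊥-elim (¬¬φ λ ())
  ⊨-stable M s (kneg φ)   ¬¬φ = λ φ′ → ¬¬φ (λ ¬φ → ¬φ φ′)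
  ⊨-stable M s (kand φ ψ) ¬¬φψ =
    ⊨-stable M s φ (λ ¬φ → ¬¬φψ (¬φ ∘ proj₁)) , ⊨-stable M s ψ (λ ¬ψ → ¬¬φψ (¬ψ ∘ proj₂))
  ⊨-stable M s (kbox a φ) ¬¬□φ = λ t st → ⊨-stable M t φ (λ ¬φ → ¬¬□φ (λ □φ → ¬φ (□φ t st)))

  ⊨⊤ : ∀ (M : Model) s → M , s ⊨ ⊤'
  ⊨⊤ M s (⊨p₀ , ⊭p₀) = ⊭p₀ ⊨p₀

  record BoundedMorphism (M₁ M₂ : Model) : Set where
    field
      h     : S M₁ → S M₂
      h-V   : ∀ x p → V M₂ (h x) p ≡ V M₁ x p
      forth : ∀ {a x y} → R M₁ a x y → R M₂ a (h x) (h y)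
      back  : ∀ {a x t} → R M₂ a (h x) t → ∃ λ y → t ≡ h y × R M₁ a x y

  ⊨-invariant : ∀ {M₁ M₂} (f : BoundedMorphism M₁ M₂) φ x →
                (M₁ , x ⊨ ⌜ φ ⌝) ⟺ (M₂ , BoundedMorphism.h f x ⊨ ⌜ φ ⌝)
  ⊨-invariant f (katom p)  x = mk⇔ (trans (h-V x p)) (trans (sym (h-V x p)))
    where open BoundedMorphism f
  ⊨-invariant f (kneg φ)   x = ¬-cong-⇔ (⊨-invariant f φ x)
  ⊨-invariant f (kand φ ψ) x = ⊨-invariant f φ x ×-⇔ ⊨-invariant f ψ x
  ⊨-invariant {M₁} {M₂} f (kbox a φ) x = mk⇔ forward backward
    where
    open BoundedMorphism f
    forward : M₁ , x ⊨ □ a ⌜ φ ⌝ → M₂ , h x ⊨ □ a ⌜ φ ⌝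
    forward □φ t xt with back xt
    ... | y , refl , xy = to (⊨-invariant f φ y) (□φ y xy)
    backward : M₂ , h x ⊨ □ a ⌜ φ ⌝ → M₁ , x ⊨ □ a ⌜ φ ⌝
    backward □φ y xy = from (⊨-invariant f φ y) (□φ (h y) (forth xy))

  record Branch : Set₁ where
    constructor branch
    field
      agent      : Agent
      model      : Model
      enumerable : Enumerable (S model)
      root       : S model

  open Branch

  _⊨ʳ_ : Branch → KForm → Set
  b ⊨ʳ φ = model b , root b ⊨ ⌜ φ ⌝

  ⨄S : List Branch → Set
  ⨄S []       = ⊥
  ⨄S (b ∷ bs) = S (model b) ⊎ ⨄S bs

  ⨄R : ∀ bs → Agent → ⨄S bs → ⨄S bs → Set
  ⨄R (b ∷ bs) a (inj₁ x) (inj₁ y) = R (model b) a x y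
  ⨄R (b ∷ bs) a (inj₂ x) (inj₂ y) = ⨄R bs a x y
  ⨄R (b ∷ bs) a (inj₁ x) (inj₂ y) = ⊥
  ⨄R (b ∷ bs) a (inj₂ x) (inj₁ y) = ⊥

  ⨄V : ∀ bs → ⨄S bs → P → Bool
  ⨄V (b ∷ bs) (inj₁ x) = V (model b) x
  ⨄V (b ∷ bs) (inj₂ y) = ⨄V bs y

  ⨄ : List Branch → Model
  ⨄ bs = record { S = ⨄S bs ; R = ⨄R bs ; V = ⨄V bs }

  ⨄-enumerable : ∀ bs → Enumerable (⨄S bs)
  ⨄-enumerable []       = Enumerable-⊥
  ⨄-enumerable (b ∷ bs) = Enumerable-⊎ (enumerable b) (⨄-enumerable bs)

  ⨄-inj₁ : ∀ b bs → BoundedMorphism (model b) (⨄ (b ∷ bs))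
  ⨄-inj₁ b bs = record { h = inj₁ ; h-V = λ _ _ → refl ; forth = λ xy → xy ; back = back }
    where
    back : ∀ {a x t} → ⨄R (b ∷ bs) a (inj₁ x) t → ∃ λ y → t ≡ inj₁ y × R (model b) a x y
    back {t = inj₁ y} xy = y , refl , xy

  ⨄-inj₂ : ∀ b bs → BoundedMorphism (⨄ bs) (⨄ (b ∷ bs))
  ⨄-inj₂ b bs = record { h = inj₂ ; h-V = λ _ _ → refl ; forth = λ xy → xy ; back = back }
    where
    back : ∀ {a x t} → ⨄R (b ∷ bs) a (inj₂ x) t → ∃ λ y → t ≡ inj₂ y × ⨄R bs a x y
    back {t = inj₂ y} xy = y , refl , xy

  IsRoot : Agent → ∀ bs → ⨄S bs → Set
  IsRoot a (b ∷ bs) (inj₁ x) = agent b ≡ a × x ≡ root b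
  IsRoot a (b ∷ bs) (inj₂ y) = IsRoot a bs y

  ⨄-roots-⊨ : ∀ {a} φ bs → All (λ b → agent b ≡ a → b ⊨ʳ φ) bs →
              ∀ y → IsRoot a bs y → ⨄ bs , y ⊨ ⌜ φ ⌝
  ⨄-roots-⊨ φ (b ∷ bs) (⊨φ ∷ _)   (inj₁ x) (refl , refl) =
    to (⊨-invariant (⨄-inj₁ b bs) φ x) (⊨φ refl)
  ⨄-roots-⊨ φ (b ∷ bs) (_ ∷ ⊨φs) (inj₂ y) y-root =
    to (⊨-invariant (⨄-inj₂ b bs) φ y) (⨄-roots-⊨ φ bs ⊨φs y y-root)

  ⨄-root-⊭ : ∀ {a} φ bs → Any (λ b → agent b ≡ a × ¬ b ⊨ʳ φ) bs →
             ∃ λ y → IsRoot a bs y × ¬ ⨄ bs , y ⊨ ⌜ φ ⌝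
  ⨄-root-⊭ φ (b ∷ bs) (here (refl , ⊭φ)) =
    inj₁ (root b) , (refl , refl) , ⊭φ ∘ from (⊨-invariant (⨄-inj₁ b bs) φ (root b))
  ⨄-root-⊭ φ (b ∷ bs) (there ⊭φs) =
    let y , y-root , ⊭φ = ⨄-root-⊭ φ bs ⊭φs
    in inj₂ y , y-root , ⊭φ ∘ from (⊨-invariant (⨄-inj₂ b bs) φ y)

  plantR : ∀ bs → Agent → Maybe (⨄S bs) → Maybe (⨄S bs) → Set
  plantR bs a nothing  (just y) = IsRoot a bs y
  plantR bs a (just x) (just y) = ⨄R bs a x y
  plantR bs a _        nothing  = ⊥

  plant : (P → Bool) → List Branch → Model
  plant v bs = record { S = Maybe (⨄S bs) ; R = plantR bs ; V = Maybe.maybe (⨄V bs) v }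

  plant-just : ∀ v bs → BoundedMorphism (⨄ bs) (plant v bs)
  plant-just v bs = record { h = just ; h-V = λ _ _ → refl ; forth = λ xy → xy ; back = back }
    where
    back : ∀ {a x t} → plantR bs a (just x) t → ∃ λ y → t ≡ just y × ⨄R bs a x y
    back {t = just y} xy = y , refl , xy

  plant-□ : ∀ {a} φ v bs → All (λ b → agent b ≡ a → b ⊨ʳ φ) bs → plant v bs , nothing ⊨ □ a ⌜ φ ⌝
  plant-□ φ v bs ⊨φs (just y) y-root =
    to (⊨-invariant (plant-just v bs) φ y) (⨄-roots-⊨ φ bs ⊨φs y y-root)

  plant-¬□ : ∀ {a} φ v bs → Any (λ b → agent b ≡ a × ¬ b ⊨ʳ φ) bs → plant v bs , nothing ⊨ (¬' □ a ⌜ φ ⌝)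
  plant-¬□ φ v bs ⊭φs □φ =
    let y , y-root , ⊭φ = ⨄-root-⊭ φ bs ⊭φs
    in ⊭φ (from (⊨-invariant (plant-just v bs) φ y) (□φ (just y) y-root))

  -- A tableau procedure for K

  data Lit : Set where
    pos neg  : P → Lit
    box nbox : Agent → KForm → Lit

  litK : Lit → KForm
  litK (pos p)    = katom p
  litK (neg p)    = kneg (katom p)
  litK (box a φ)  = kbox a φ
  litK (nbox a φ) = kneg (kbox a φ)

  ⌞_⌟ : Lit → Form
  ⌞ l ⌟ = ⌜ litK l ⌝

  ⋀ᴸ : List Lit → Form
  ⋀ᴸ Δ = ⋀ (map ⌞_⌟ Δ)

  ⋀ᴷ : List KForm → Form
  ⋀ᴷ Γ = ⋀ (map ⌜_⌝ Γ)

  ⋀ᴸ-∈ : ∀ {l Δ} → l ∈ Δ → ⊢ (⋀ᴸ Δ ⇒ ⌞ l ⌟)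
  ⋀ᴸ-∈ l∈Δ = ⋀-∈ (∈-map⁺ ⌞_⌟ l∈Δ)

  DepthBounded : ℕ → List Lit → Set
  DepthBounded n = All (λ l → depth (litK l) ≤ n)

  boxes : Agent → List Lit → List KForm
  boxes a []             = []
  boxes a (pos p ∷ Δ)    = boxes a Δ
  boxes a (neg p ∷ Δ)    = boxes a Δ
  boxes a (nbox b ψ ∷ Δ) = boxes a Δ
  boxes a (box b ψ ∷ Δ) with a ≟ᴬ b
  ... | yes _ = ψ ∷ boxes a Δ
  ... | no  _ = boxes a Δ

  boxes-∈ : ∀ {a ψ} Δ → box a ψ ∈ Δ → ψ ∈ boxes a Δ
  boxes-∈ (pos p ∷ Δ)    (there m) = boxes-∈ Δ m
  boxes-∈ (neg p ∷ Δ)    (there m) = boxes-∈ Δ m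
  boxes-∈ (nbox b χ ∷ Δ) (there m) = boxes-∈ Δ m
  boxes-∈ {a} (box b χ ∷ Δ) m with a ≟ᴬ b | m
  ... | yes refl | here refl = here refl
  ... | yes refl | there m′  = there (boxes-∈ Δ m′)
  ... | no  a≢b  | here refl = ⊥-elim (a≢b refl)
  ... | no  _    | there m′  = boxes-∈ Δ m′

  boxes⁺ : ∀ {Q : Lit → Set} {Q′ : KForm → Set} a → (∀ {ψ} → Q (box a ψ) → Q′ ψ) →
           ∀ {Δ} → All Q Δ → All Q′ (boxes a Δ)
  boxes⁺ a f {[]}           []       = []
  boxes⁺ a f {pos p ∷ Δ}    (_ ∷ qs) = boxes⁺ a f qs
  boxes⁺ a f {neg p ∷ Δ}    (_ ∷ qs) = boxes⁺ a f qs
  boxes⁺ a f {nbox b ψ ∷ Δ} (_ ∷ qs) = boxes⁺ a f qs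
  boxes⁺ a f {box b ψ ∷ Δ}  (q ∷ qs) with a ≟ᴬ b
  ... | yes refl = f q ∷ boxes⁺ a f qs
  ... | no  _    = boxes⁺ a f qs

  boxes-⊢ : ∀ a Δ → ⊢ (⋀ᴸ Δ ⇒ □ a (⋀ᴷ (boxes a Δ)))
  boxes-⊢ a [] = MP (taut (x₀ ⇒ₚ x₁ ⇒ₚ x₀) (□ a ⊤' ∷ ⊤' ∷ [])) (N a ⊢⊤)
  boxes-⊢ a (pos p ∷ Δ)    = ∧-⇒ʳ (atom p) (boxes-⊢ a Δ)
  boxes-⊢ a (neg p ∷ Δ)    = ∧-⇒ʳ ⌞ neg p ⌟ (boxes-⊢ a Δ)
  boxes-⊢ a (nbox b ψ ∷ Δ) = ∧-⇒ʳ ⌞ nbox b ψ ⌟ (boxes-⊢ a Δ)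
  boxes-⊢ a (box b ψ ∷ Δ) with a ≟ᴬ b
  ... | no _     = ∧-⇒ʳ (□ b ⌜ ψ ⌝) (boxes-⊢ a Δ)
  ... | yes refl =
    MP₂ (taut ((x₀ ⇒ₚ x₁ ⇒ₚ x₂) ⇒ₚ (x₃ ⇒ₚ x₁) ⇒ₚ (x₀ ∧ₚ x₃ ⇒ₚ x₂))
              (□ a ⌜ ψ ⌝ ∷ □ a Ψ ∷ □ a (⌜ ψ ⌝ ∧' Ψ) ∷ ⋀ᴸ Δ ∷ []))
        (□-mono₂ a (taut (x₀ ⇒ₚ x₁ ⇒ₚ x₀ ∧ₚ x₁) (⌜ ψ ⌝ ∷ Ψ ∷ [])))
        (boxes-⊢ a Δ)
    where Ψ = ⋀ᴷ (boxes a Δ)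

  Holds : (M : Model) → S M → List Lit → List KForm → Set
  Holds M s Δ Γ = All (λ l → M , s ⊨ ⌞ l ⌟) Δ × All (λ φ → M , s ⊨ ⌜ φ ⌝) Γ

  -- The semantic half spares us a soundness theorem for OML.
  Refuted : List Lit → List KForm → Set₁
  Refuted Δ Γ = ⊢ ¬' (⋀ᴸ Δ ∧' ⋀ᴷ Γ) × (∀ (M : Model) s → ¬ Holds M s Δ Γ)

  Satisfiable : List Lit → List KForm → Set₁
  Satisfiable Δ Γ = Σ Model λ M → Enumerable (S M) × Σ (S M) λ s → Holds M s Δ Γ

  Decided : List Lit → List KForm → Set₁
  Decided Δ Γ = Refuted Δ Γ ⊎ Satisfiable Δ Γ

  Decided-lit : ∀ {Δ Γ} l → Decided (l ∷ Δ) Γ → Decided Δ (litK l ∷ Γ)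
  Decided-lit {Δ} {Γ} l (inj₁ (⊢¬ , ⊭)) =
    inj₁ ( MP (taut (¬ₚ ((x₀ ∧ₚ x₁) ∧ₚ x₂) ⇒ₚ ¬ₚ (x₁ ∧ₚ x₀ ∧ₚ x₂)) (⌞ l ⌟ ∷ ⋀ᴸ Δ ∷ ⋀ᴷ Γ ∷ [])) ⊢¬
         , λ { M s (⊨Δ , ⊨l ∷ ⊨Γ) → ⊭ M s (⊨l ∷ ⊨Δ , ⊨Γ) } )
  Decided-lit l (inj₂ (M , e , s , ⊨l ∷ ⊨Δ , ⊨Γ)) = inj₂ (M , e , s , ⊨Δ , ⊨l ∷ ⊨Γ)

  Decided-∧ : ∀ {Δ Γ} A B → Decided Δ (A ∷ B ∷ Γ) → Decided Δ (kand A B ∷ Γ)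
  Decided-∧ {Δ} {Γ} A B (inj₁ (⊢¬ , ⊭)) =
    inj₁ ( MP (taut (¬ₚ (x₀ ∧ₚ x₁ ∧ₚ x₂ ∧ₚ x₃) ⇒ₚ ¬ₚ (x₀ ∧ₚ (x₁ ∧ₚ x₂) ∧ₚ x₃))
                    (⋀ᴸ Δ ∷ ⌜ A ⌝ ∷ ⌜ B ⌝ ∷ ⋀ᴷ Γ ∷ [])) ⊢¬
         , λ { M s (⊨Δ , (⊨A , ⊨B) ∷ ⊨Γ) → ⊭ M s (⊨Δ , ⊨A ∷ ⊨B ∷ ⊨Γ) } )
  Decided-∧ A B (inj₂ (M , e , s , ⊨Δ , ⊨A ∷ ⊨B ∷ ⊨Γ)) = inj₂ (M , e , s , ⊨Δ , (⊨A , ⊨B) ∷ ⊨Γ)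

  Decided-¬¬ : ∀ {Δ Γ} A → Decided Δ (A ∷ Γ) → Decided Δ (kneg (kneg A) ∷ Γ)
  Decided-¬¬ {Δ} {Γ} A (inj₁ (⊢¬ , ⊭)) =
    inj₁ ( MP (taut (¬ₚ (x₀ ∧ₚ x₁ ∧ₚ x₂) ⇒ₚ ¬ₚ (x₀ ∧ₚ ¬ₚ ¬ₚ x₁ ∧ₚ x₂)) (⋀ᴸ Δ ∷ ⌜ A ⌝ ∷ ⋀ᴷ Γ ∷ [])) ⊢¬
         , λ { M s (⊨Δ , ⊨¬¬A ∷ ⊨Γ) → ⊭ M s (⊨Δ , ⊨-stable M s A ⊨¬¬A ∷ ⊨Γ) } )
  Decided-¬¬ A (inj₂ (M , e , s , ⊨Δ , ⊨A ∷ ⊨Γ)) = inj₂ (M , e , s , ⊨Δ , (λ ¬A → ¬A ⊨A) ∷ ⊨Γ)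

  Decided-¬∧ : ∀ {Δ Γ} A B → Decided Δ (kneg A ∷ Γ) → Decided Δ (kneg B ∷ Γ) →
               Decided Δ (kneg (kand A B) ∷ Γ)
  Decided-¬∧ A B (inj₂ (M , e , s , ⊨Δ , ⊭A ∷ ⊨Γ)) _ = inj₂ (M , e , s , ⊨Δ , ⊭A ∘ proj₁ ∷ ⊨Γ)
  Decided-¬∧ A B (inj₁ _) (inj₂ (M , e , s , ⊨Δ , ⊭B ∷ ⊨Γ)) = inj₂ (M , e , s , ⊨Δ , ⊭B ∘ proj₂ ∷ ⊨Γ)
  Decided-¬∧ {Δ} {Γ} A B (inj₁ (⊢¬₁ , ⊭₁)) (inj₁ (⊢¬₂ , ⊭₂)) =
    inj₁ ( MP₂ (taut (¬ₚ (x₀ ∧ₚ ¬ₚ x₁ ∧ₚ x₃) ⇒ₚ ¬ₚ (x₀ ∧ₚ ¬ₚ x₂ ∧ₚ x₃) ⇒ₚ ¬ₚ (x₀ ∧ₚ ¬ₚ (x₁ ∧ₚ x₂) ∧ₚ x₃))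
                     (⋀ᴸ Δ ∷ ⌜ A ⌝ ∷ ⌜ B ⌝ ∷ ⋀ᴷ Γ ∷ [])) ⊢¬₁ ⊢¬₂
         , λ { M s (⊨Δ , ⊭AB ∷ ⊨Γ) →
                 ⊭₁ M s (⊨Δ , (λ ⊨A → ⊭₂ M s (⊨Δ , (λ ⊨B → ⊭AB (⊨A , ⊨B)) ∷ ⊨Γ)) ∷ ⊨Γ) } )

  clash-refuted : ∀ {p Δ Γ} → pos p ∈ Δ → neg p ∈ Δ → Refuted Δ Γ
  clash-refuted {Γ = Γ} pos∈ neg∈ =
      ⊢¬∧ (⋀ᴷ Γ) (⋀ᴸ-∈ pos∈) (⋀ᴸ-∈ neg∈)
    , λ { M s (⊨Δ , _) → All.lookup ⊨Δ neg∈ (All.lookup ⊨Δ pos∈) }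

  successor-refuted : ∀ {a χ Δ Γ} → nbox a χ ∈ Δ → Refuted [] (kneg χ ∷ boxes a Δ) → Refuted Δ Γ
  successor-refuted {a} {χ} {Δ} {Γ} nbox∈ (⊢¬ , ⊭) =
    ⊢¬∧ (⋀ᴷ Γ) (⇒-trans (boxes-⊢ a Δ) (□-mono a Ψ⇒χ)) (⋀ᴸ-∈ nbox∈) , ⊭Δ
    where
    Ψ = ⋀ᴷ (boxes a Δ)
    Ψ⇒χ : ⊢ (Ψ ⇒ ⌜ χ ⌝)
    Ψ⇒χ = MP (taut (¬ₚ (⊤ₚ ∧ₚ ¬ₚ x₁ ∧ₚ x₂) ⇒ₚ x₂ ⇒ₚ x₁) (atom p₀ ∷ ⌜ χ ⌝ ∷ Ψ ∷ [])) ⊢¬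
    ⊭Δ : ∀ (M : Model) s → ¬ Holds M s Δ Γ
    ⊭Δ M s (⊨Δ , _) = All.lookup ⊨Δ nbox∈ λ t st →
      ⊨-stable M t χ (λ ⊭χ → ⊭ M t ([] , ⊭χ ∷ boxes⁺ a (λ □ψ → □ψ t st) ⊨Δ))

  positives : List Lit → List P
  positives []             = []
  positives (pos p ∷ Δ)    = p ∷ positives Δ
  positives (neg p ∷ Δ)    = positives Δ
  positives (box a φ ∷ Δ)  = positives Δ
  positives (nbox a φ ∷ Δ) = positives Δ

  positives⁺ : ∀ {p} Δ → pos p ∈ Δ → p ∈ positives Δ
  positives⁺ (pos q ∷ Δ)    (here refl) = here refl
  positives⁺ (pos q ∷ Δ)    (there m)   = there (positives⁺ Δ m)
  positives⁺ (neg q ∷ Δ)    (there m)   = positives⁺ Δ m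
  positives⁺ (box a φ ∷ Δ)  (there m)   = positives⁺ Δ m
  positives⁺ (nbox a φ ∷ Δ) (there m)   = positives⁺ Δ m

  positives⁻ : ∀ {p} Δ → p ∈ positives Δ → pos p ∈ Δ
  positives⁻ (pos q ∷ Δ)    (here refl) = here refl
  positives⁻ (pos q ∷ Δ)    (there m)   = there (positives⁻ Δ m)
  positives⁻ (neg q ∷ Δ)    m           = there (positives⁻ Δ m)
  positives⁻ (box a φ ∷ Δ)  m           = there (positives⁻ Δ m)
  positives⁻ (nbox a φ ∷ Δ) m           = there (positives⁻ Δ m)

  valuation : List Lit → P → Bool
  valuation Δ p = does (p ∈? positives Δ)

  valuation-pos : ∀ {p} Δ → pos p ∈ Δ → valuation Δ p ≡ true
  valuation-pos {p} Δ pos∈ = dec-true (p ∈? positives Δ) (positives⁺ Δ pos∈)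

  valuation-neg : ∀ {p} Δ → ¬ pos p ∈ Δ → ¬ valuation Δ p ≡ true
  valuation-neg {p} Δ pos∉ with p ∈? positives Δ
  ... | yes p∈ = λ _ → pos∉ (positives⁻ Δ p∈)
  ... | no  _  = λ ()

  Consistent : List Lit → Set
  Consistent Δ = ∀ {p} → neg p ∈ Δ → ¬ pos p ∈ Δ

  Clashes : List Lit → Lit → Set
  Clashes Δ (neg p)    = p ∈ positives Δ
  Clashes Δ (pos p)    = ⊥
  Clashes Δ (box a φ)  = ⊥
  Clashes Δ (nbox a φ) = ⊥

  clashes? : ∀ Δ l → Dec (Clashes Δ l)
  clashes? Δ (neg p)    = p ∈? positives Δ
  clashes? Δ (pos p)    = no λ ()
  clashes? Δ (box a φ)  = no λ ()
  clashes? Δ (nbox a φ) = no λ ()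

  clash? : ∀ Δ → (Σ P λ p → pos p ∈ Δ × neg p ∈ Δ) ⊎ Consistent Δ
  clash? Δ with any? (clashes? Δ) Δ
  ... | no ¬clash = inj₂ λ neg∈ pos∈ → ¬clash (lose neg∈ (positives⁺ Δ pos∈))
  ... | yes clash with find clash
  ...   | neg p , neg∈ , p∈ = inj₁ (p , positives⁻ Δ p∈ , neg∈)

  Fits : List Lit → Branch → Set
  Fits Δ b = All (b ⊨ʳ_) (boxes (agent b) Δ)

  Witnessed : List Branch → List Lit → Set₁
  Witnessed bs Δ = ∀ {a χ} → nbox a χ ∈ Δ → Any (λ b → agent b ≡ a × ¬ b ⊨ʳ χ) bs

  Successors : List Lit → List Lit → Set₁
  Successors Δ₀ Δ = Σ (List Branch) λ bs → All (Fits Δ₀) bs × Witnessed bs Δ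

  SuccessorRefuted : List Lit → List Lit → Set₁
  SuccessorRefuted Δ₀ Δ = Σ Agent λ a → Σ KForm λ χ → nbox a χ ∈ Δ × Refuted [] (kneg χ ∷ boxes a Δ₀)

  DecidableBelow : ℕ → Set₁
  DecidableBelow zero    = Lift _ ⊤
  DecidableBelow (suc n) = ∀ Γ → All (λ φ → depth φ ≤ n) Γ → Decided [] Γ

  skip-non-nbox : ∀ Δ₀ {Δ} l → (∀ {a χ} → nbox a χ ≢ l) →
                  SuccessorRefuted Δ₀ Δ ⊎ Successors Δ₀ Δ →
                  SuccessorRefuted Δ₀ (l ∷ Δ) ⊎ Successors Δ₀ (l ∷ Δ)
  skip-non-nbox Δ₀ l l≢nbox = Sum.map
    (λ (a , χ , m , refuted) → a , χ , there m , refuted)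
    (λ (bs , fits , witnessed) → bs , fits , λ { (here eq) → ⊥-elim (l≢nbox eq) ; (there m) → witnessed m })

  successors? : ∀ {n} → DecidableBelow n → ∀ Δ₀ → DepthBounded n Δ₀ → ∀ Δ → DepthBounded n Δ →
                SuccessorRefuted Δ₀ Δ ⊎ Successors Δ₀ Δ
  successors? ih Δ₀ b₀ []            []       = inj₂ ([] , [] , λ ())
  successors? ih Δ₀ b₀ (pos p ∷ Δ)   (_ ∷ bΔ) = skip-non-nbox Δ₀ (pos p) (λ ()) (successors? ih Δ₀ b₀ Δ bΔ)
  successors? ih Δ₀ b₀ (neg p ∷ Δ)   (_ ∷ bΔ) = skip-non-nbox Δ₀ (neg p) (λ ()) (successors? ih Δ₀ b₀ Δ bΔ)
  successors? ih Δ₀ b₀ (box a χ ∷ Δ) (_ ∷ bΔ) = skip-non-nbox Δ₀ (box a χ) (λ ()) (successors? ih Δ₀ b₀ Δ bΔ)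
  successors? {suc n} ih Δ₀ b₀ (nbox a χ ∷ Δ) (s≤s dχ ∷ bΔ)
    with ih (kneg χ ∷ boxes a Δ₀) (dχ ∷ boxes⁺ a s≤s⁻¹ b₀)
  ... | inj₁ refuted = inj₁ (a , χ , here refl , refuted)
  ... | inj₂ (M , e , s , [] , ⊭χ ∷ ⊨boxes) with successors? ih Δ₀ b₀ Δ bΔ
  ...   | inj₁ (a′ , χ′ , m , refuted) = inj₁ (a′ , χ′ , there m , refuted)
  ...   | inj₂ (bs , fits , witnessed) =
          inj₂ ( branch a M e s ∷ bs , ⊨boxes ∷ fits
               , λ { (here refl) → here (refl , ⊭χ) ; (there m) → there (witnessed m) } )

  plant-⊨ : ∀ {Δ} bs → Consistent Δ → All (Fits Δ) bs → Witnessed bs Δ →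
            All (λ l → plant (valuation Δ) bs , nothing ⊨ ⌞ l ⌟) Δ
  plant-⊨ {Δ} bs consistent fits witnessed = All.tabulate ⊨l
    where
    ⊨l : ∀ {l} → l ∈ Δ → plant (valuation Δ) bs , nothing ⊨ ⌞ l ⌟
    ⊨l {pos p}    m = valuation-pos Δ m
    ⊨l {neg p}    m = valuation-neg Δ (consistent m)
    ⊨l {box a ψ}  m = plant-□ ψ (valuation Δ) bs
      (All.map (λ fit a≡ → All.lookup fit (subst (λ c → ψ ∈ boxes c Δ) (sym a≡) (boxes-∈ Δ m))) fits)
    ⊨l {nbox a χ} m = plant-¬□ χ (valuation Δ) bs (witnessed m)

  decide-literals : ∀ {n} → DecidableBelow n → ∀ Δ → DepthBounded n Δ → Decided Δ []
  decide-literals ih Δ bΔ with clash? Δ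
  ... | inj₁ (p , pos∈ , neg∈) = inj₁ (clash-refuted pos∈ neg∈)
  ... | inj₂ consistent with successors? ih Δ bΔ Δ bΔ
  ...   | inj₁ (a , χ , nbox∈ , refuted) = inj₁ (successor-refuted nbox∈ refuted)
  ...   | inj₂ (bs , fits , witnessed) =
          inj₂ ( plant (valuation Δ) bs , Enumerable-Maybe (⨄-enumerable bs)
               , nothing , plant-⊨ bs consistent fits witnessed , [] )

  -- Continuation-passing style keeps the recursion structural in A.
  decide-with : ∀ {n Γ} A → depth A ≤ n → (∀ Δ → DepthBounded n Δ → Decided Δ Γ) →
                ∀ Δ → DepthBounded n Δ → Decided Δ (A ∷ Γ)
  decide-with (katom p)         _ k Δ bΔ = Decided-lit (pos p) (k (pos p ∷ Δ) (z≤n ∷ bΔ))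
  decide-with (kbox a A)        d k Δ bΔ = Decided-lit (box a A) (k (box a A ∷ Δ) (d ∷ bΔ))
  decide-with (kneg (katom p))  _ k Δ bΔ = Decided-lit (neg p) (k (neg p ∷ Δ) (z≤n ∷ bΔ))
  decide-with (kneg (kbox a A)) d k Δ bΔ = Decided-lit (nbox a A) (k (nbox a A ∷ Δ) (d ∷ bΔ))
  decide-with (kneg (kneg A))   d k Δ bΔ = Decided-¬¬ A (decide-with A d k Δ bΔ)
  decide-with (kand A B)        d k Δ bΔ =
    Decided-∧ A B (decide-with A (m⊔n≤o⇒m≤o _ _ d) (decide-with B (m⊔n≤o⇒n≤o _ _ d) k) Δ bΔ)
  decide-with (kneg (kand A B)) d k Δ bΔ =
    Decided-¬∧ A B (decide-with (kneg A) (m⊔n≤o⇒m≤o _ _ d) k Δ bΔ)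
                   (decide-with (kneg B) (m⊔n≤o⇒n≤o _ _ d) k Δ bΔ)

  decide-all : ∀ {n Γ} → All (λ φ → depth φ ≤ n) Γ → (∀ Δ → DepthBounded n Δ → Decided Δ []) →
               ∀ Δ → DepthBounded n Δ → Decided Δ Γ
  decide-all []                   k = k
  decide-all {Γ = A ∷ Γ} (d ∷ ds) k = decide-with A d (decide-all ds k)

  decide : ∀ n Γ → All (λ φ → depth φ ≤ n) Γ → Decided [] Γ
  decidableBelow : ∀ n → DecidableBelow n

  decide n Γ bΓ = decide-all bΓ (decide-literals (decidableBelow n)) [] []

  decidableBelow zero    = lift tt
  decidableBelow (suc n) = decide n

  ValidK : KForm → Set₁
  ValidK φ = ∀ (M : Model) s → M , s ⊨ ⌜ φ ⌝

  Countermodel : KForm → Set₁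
  Countermodel φ = Σ Model λ M → Enumerable (S M) × Σ (S M) λ s → ¬ M , s ⊨ ⌜ φ ⌝

  provable⊎countermodel : ∀ φ → (⊢ ⌜ φ ⌝ × ValidK φ) ⊎ Countermodel φ
  provable⊎countermodel φ with decide (depth φ) (kneg φ ∷ []) (≤-refl ∷ [])
  ... | inj₁ (⊢¬ , ⊭) = inj₁ ( MP (taut (¬ₚ (⊤ₚ ∧ₚ ¬ₚ x₁ ∧ₚ ⊤ₚ) ⇒ₚ x₁) (atom p₀ ∷ ⌜ φ ⌝ ∷ [])) ⊢¬
                             , λ M s → ⊨-stable M s φ λ ⊭φ → ⊭ M s ([] , ⊭φ ∷ []) )
  ... | inj₂ (M , e , s , [] , ⊭φ ∷ []) = inj₂ (M , e , s , ⊭φ)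

  -- Eliminating [∘]

  data BForm : Set where
    batom : P → BForm
    bneg  : BForm → BForm
    band  : BForm → BForm → BForm

  toK : BForm → KForm
  toK (batom p)  = katom p
  toK (bneg χ)   = kneg (toK χ)
  toK (band χ ψ) = kand (toK χ) (toK ψ)

  ⌜_⌝ᴮ : BForm → Form
  ⌜ χ ⌝ᴮ = ⌜ toK χ ⌝

  ⊤ᴮ ⊥ᴮ : BForm
  ⊤ᴮ = bneg (band (batom p₀) (bneg (batom p₀)))
  ⊥ᴮ = bneg ⊤ᴮ

  atomsᴮ : BForm → List P
  atomsᴮ (batom p)  = p ∷ []
  atomsᴮ (bneg χ)   = atomsᴮ χ
  atomsᴮ (band χ ψ) = atomsᴮ χ ++ atomsᴮ ψ

  IsL0-⌜⌝ᴮ : ∀ χ → IsL0 ⌜ χ ⌝ᴮ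
  IsL0-⌜⌝ᴮ (batom p)  = tt
  IsL0-⌜⌝ᴮ (bneg χ)   = IsL0-⌜⌝ᴮ χ
  IsL0-⌜⌝ᴮ (band χ ψ) = IsL0-⌜⌝ᴮ χ , IsL0-⌜⌝ᴮ ψ

  ⊨ᴮ-valuation : ∀ (M : Model) s χ → (M , s ⊨ ⌜ χ ⌝ᴮ) ⟺ (M∘ , V M s ⊨ ⌜ χ ⌝ᴮ)
  ⊨ᴮ-valuation M s (batom p)  = mk⇔ id id
  ⊨ᴮ-valuation M s (bneg χ)   = ¬-cong-⇔ (⊨ᴮ-valuation M s χ)
  ⊨ᴮ-valuation M s (band χ ψ) = ⊨ᴮ-valuation M s χ ×-⇔ ⊨ᴮ-valuation M s ψ

  ⊨ᴮ? : ∀ w χ → Dec (M∘ , w ⊨ ⌜ χ ⌝ᴮ)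
  ⊨ᴮ? w (batom p)  = w p ≟ᵇ true
  ⊨ᴮ? w (bneg χ)   = ¬? (⊨ᴮ? w χ)
  ⊨ᴮ? w (band χ ψ) = ⊨ᴮ? w χ ×-dec ⊨ᴮ? w ψ

  ∈-mapL⁺ : ∀ {X Y : Set} (f : X → Y) {x xs} → x ∈ xs → f x ∈ mapL f xs
  ∈-mapL⁺ f (here refl) = here refl
  ∈-mapL⁺ f (there x∈)  = there (∈-mapL⁺ f x∈)

  IsL0-⋀-mapL : ∀ (f : P → Form) → (∀ p → IsL0 (f p)) → ∀ Q → IsL0 (⋀ (mapL f Q))
  IsL0-⋀-mapL f L0 []      = tt , tt
  IsL0-⋀-mapL f L0 (p ∷ Q) = L0 p , IsL0-⋀-mapL f L0 Q

  trues falses : (P → Bool) → List P → List P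
  trues  w = filter (λ p → w p ≟ᵇ true)
  falses w = filter (λ p → ¬? (w p ≟ᵇ true))

  trues-falses-disjoint : ∀ w Q {p} → p ∈ trues w Q → p ∉ falses w Q
  trues-falses-disjoint w Q p∈₁ p∈₂ =
    proj₂ (∈-filter⁻ (λ q → ¬? (w q ≟ᵇ true)) {xs = Q} p∈₂)
          (proj₂ (∈-filter⁻ (λ q → w q ≟ᵇ true) {xs = Q} p∈₁))

  describe : (P → Bool) → List P → Form
  describe w Q = ⋀ (mapL atom (trues w Q)) ∧' ⋀ (mapL (λ p → ¬' atom p) (falses w Q))

  describe-atom : ∀ w {Q p} → p ∈ Q →
    (w p ≡ true → ⊢ (describe w Q ⇒ atom p)) × (¬ w p ≡ true → ⊢ (describe w Q ⇒ ¬' atom p))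
  describe-atom w {Q} {p} p∈Q =
      (λ wp → ∧-⇒ˡ Neg (⋀-∈ (∈-mapL⁺ atom (∈-filter⁺ (λ q → w q ≟ᵇ true) p∈Q wp))))
    , (λ ¬wp → ∧-⇒ʳ Pos (⋀-∈ (∈-mapL⁺ (λ q → ¬' atom q) (∈-filter⁺ (λ q → ¬? (w q ≟ᵇ true)) p∈Q ¬wp))))
    where
    Pos = ⋀ (mapL atom (trues w Q))
    Neg = ⋀ (mapL (λ q → ¬' atom q) (falses w Q))

  describe-⊢ : ∀ w Q χ → atomsᴮ χ ⊆ Q →
    (M∘ , w ⊨ ⌜ χ ⌝ᴮ → ⊢ (describe w Q ⇒ ⌜ χ ⌝ᴮ)) ×
    (¬ M∘ , w ⊨ ⌜ χ ⌝ᴮ → ⊢ (describe w Q ⇒ ¬' ⌜ χ ⌝ᴮ))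
  describe-⊢ w Q (batom p) ⊆Q = describe-atom w (⊆Q (here refl))
  describe-⊢ w Q (bneg χ) ⊆Q = ⊢¬χ , ⊢¬¬χ
    where
    ⊢¬χ = proj₂ (describe-⊢ w Q χ ⊆Q)
    ⊢¬¬χ : ¬ ¬ M∘ , w ⊨ ⌜ χ ⌝ᴮ → ⊢ (describe w Q ⇒ ¬' ¬' ⌜ χ ⌝ᴮ)
    ⊢¬¬χ ¬¬χ with ⊨ᴮ? w χ
    ... | yes ⊨χ = ⇒-trans (proj₁ (describe-⊢ w Q χ ⊆Q) ⊨χ) (taut (x₀ ⇒ₚ ¬ₚ ¬ₚ x₀) (⌜ χ ⌝ᴮ ∷ []))
    ... | no  ⊭χ = ⊥-elim (¬¬χ ⊭χ)
  describe-⊢ w Q (band χ ψ) ⊆Q = ⊢χψ , ⊢¬χψ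
    where
    L = describe w Q
    IHχ = describe-⊢ w Q χ (⊆Q ∘ ∈-++⁺ˡ)
    IHψ = describe-⊢ w Q ψ (⊆Q ∘ ∈-++⁺ʳ (atomsᴮ χ))
    ⊢χψ : M∘ , w ⊨ ⌜ band χ ψ ⌝ᴮ → ⊢ (L ⇒ ⌜ band χ ψ ⌝ᴮ)
    ⊢χψ (⊨χ , ⊨ψ) = MP₂ (taut ((x₀ ⇒ₚ x₁) ⇒ₚ (x₀ ⇒ₚ x₂) ⇒ₚ (x₀ ⇒ₚ x₁ ∧ₚ x₂)) (L ∷ ⌜ χ ⌝ᴮ ∷ ⌜ ψ ⌝ᴮ ∷ []))
                         (proj₁ IHχ ⊨χ) (proj₁ IHψ ⊨ψ)
    ⊢¬χψ : ¬ M∘ , w ⊨ ⌜ band χ ψ ⌝ᴮ → ⊢ (L ⇒ ¬' ⌜ band χ ψ ⌝ᴮ)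
    ⊢¬χψ ⊭χψ with ⊨ᴮ? w χ
    ... | no ⊭χ  = MP (taut ((x₀ ⇒ₚ ¬ₚ x₁) ⇒ₚ (x₀ ⇒ₚ ¬ₚ (x₁ ∧ₚ x₂))) (L ∷ ⌜ χ ⌝ᴮ ∷ ⌜ ψ ⌝ᴮ ∷ []))
                      (proj₂ IHχ ⊭χ)
    ... | yes ⊨χ = MP (taut ((x₀ ⇒ₚ ¬ₚ x₂) ⇒ₚ (x₀ ⇒ₚ ¬ₚ (x₁ ∧ₚ x₂))) (L ∷ ⌜ χ ⌝ᴮ ∷ ⌜ ψ ⌝ᴮ ∷ []))
                      (proj₂ IHψ λ ⊨ψ → ⊭χψ (⊨χ , ⊨ψ))

  -- L describes the valuation w on the atoms of χ, so L ⇒ ¬ φ holds under [∘];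
  -- as OFull makes L possible, □ₐ φ fails under [∘].
  [∘]-¬□ : ∀ a φ χ w → ⊢ ([∘] φ ⇔ ⌜ χ ⌝ᴮ) → ¬ M∘ , w ⊨ ⌜ χ ⌝ᴮ → ⊢ ¬' [∘] (□ a φ)
  [∘]-¬□ a φ χ w [∘]φ⇔χ ⊭χ = MP (⇔-to (ODual (□ a φ))) (OMP (OMP ([∘]-nec K-step) [∘]□[L⇒¬φ]) [∘]◇L)
    where
    Q₁ = trues w (atomsᴮ χ)
    Q₂ = falses w (atomsᴮ χ)
    L  = describe w (atomsᴮ χ)
    L⇒¬χ : ⊢ (L ⇒ ¬' ⌜ χ ⌝ᴮ)
    L⇒¬χ = proj₂ (describe-⊢ w (atomsᴮ χ) χ id) ⊭χ
    [∘]L⇔L : ⊢ ([∘] L ⇔ L)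
    [∘]L⇔L = O1 L (IsL0-⋀-mapL atom (λ _ → tt) Q₁ , IsL0-⋀-mapL (λ p → ¬' atom p) (λ _ → tt) Q₂)
    [∘]L⇒¬[∘]φ : ⊢ ([∘] L ⇒ ¬' [∘] φ)
    [∘]L⇒¬[∘]φ = MP₂ (MP (taut ((x₀ ⇔ₚ x₁) ⇒ₚ (x₂ ⇔ₚ x₃) ⇒ₚ (x₁ ⇒ₚ ¬ₚ x₃) ⇒ₚ (x₀ ⇒ₚ ¬ₚ x₂))
                                ([∘] L ∷ L ∷ [∘] φ ∷ ⌜ χ ⌝ᴮ ∷ [])) [∘]L⇔L) [∘]φ⇔χ L⇒¬χ
    [∘]□[L⇒¬φ] : ⊢ [∘] (□ a (L ⇒ ¬' φ))
    [∘]□[L⇒¬φ] = ON a (MP (⇔-from ([∘]-⇒ L (¬' φ))) (⇒-trans [∘]L⇒¬[∘]φ (⇔-from (ODual φ))))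
    [∘]◇L : ⊢ [∘] (◇ a L)
    [∘]◇L = OFull a Q₁ Q₂ λ p → trues-falses-disjoint w (atomsᴮ χ)
    K-step : ⊢ (□ a (L ⇒ ¬' φ) ⇒ ◇ a L ⇒ ¬' □ a φ)
    K-step = MP (taut ((x₀ ⇒ₚ x₁ ⇒ₚ x₂) ⇒ₚ (x₁ ⇒ₚ ¬ₚ x₂ ⇒ₚ ¬ₚ x₀))
                      (□ a φ ∷ □ a (L ⇒ ¬' φ) ∷ □ a (¬' L) ∷ []))
                (□-mono₂ a (taut (x₀ ⇒ₚ (x₁ ⇒ₚ ¬ₚ x₀) ⇒ₚ ¬ₚ x₁) (φ ∷ L ∷ [])))

  ⊤ᴮ-or-⊥ᴮ : ∀ {X Y : Set₁} → X ⊎ Y → BForm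
  ⊤ᴮ-or-⊥ᴮ (inj₁ _) = ⊤ᴮ
  ⊤ᴮ-or-⊥ᴮ (inj₂ _) = ⊥ᴮ

  -- Since □ₐ φ is constant on M∘, it is replaced by ⊤ or ⊥ according to K-validity of flat φ.
  flat : Form → BForm
  flat (atom p) = batom p
  flat (¬' φ)   = bneg (flat φ)
  flat (φ ∧' ψ) = band (flat φ) (flat ψ)
  flat (□ a φ)  = ⊤ᴮ-or-⊥ᴮ (provable⊎countermodel (toK (flat φ)))
  flat ([∘] φ)  = flat φ

  flat-⊨ : ∀ φ w → (M∘ , w ⊨ φ) ⟺ (M∘ , w ⊨ ⌜ flat φ ⌝ᴮ)
  flat-⊨ (atom p) w = mk⇔ id id
  flat-⊨ (¬' φ)   w = ¬-cong-⇔ (flat-⊨ φ w)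
  flat-⊨ (φ ∧' ψ) w = flat-⊨ φ w ×-⇔ flat-⊨ ψ w
  flat-⊨ ([∘] φ)  w = flat-⊨ φ w
  flat-⊨ (□ a φ)  w with provable⊎countermodel (toK (flat φ))
  ... | inj₁ (_ , valid) = mk⇔ (λ _ → ⊨⊤ M∘ w) (λ _ t _ → from (flat-⊨ φ t) (valid M∘ t))
  ... | inj₂ (M , _ , s , ⊭φ) = mk⇔ (λ □φ → ⊥-elim (⊭φ (from (⊨ᴮ-valuation M s (flat φ)) (⊨φ-at (V M s) □φ))))
                                    (λ ⊨⊥ → ⊥-elim (⊨⊥ (⊨⊤ M∘ w)))
    where
    ⊨φ-at : ∀ v → M∘ , w ⊨ □ a φ → M∘ , v ⊨ ⌜ flat φ ⌝ᴮ
    ⊨φ-at v □φ = to (flat-⊨ φ v) (□φ v tt)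

  flat-⊢ : ∀ φ → ⊢ ([∘] φ ⇔ ⌜ flat φ ⌝ᴮ)
  flat-⊢ (atom p) = O1 (atom p) tt
  flat-⊢ (¬' φ)   = ⇔-trans (ODual φ) (¬-cong (flat-⊢ φ))
  flat-⊢ (φ ∧' ψ) = ⇔-trans ([∘]-∧ φ ψ) (∧-cong (flat-⊢ φ) (flat-⊢ ψ))
  flat-⊢ ([∘] φ)  = ⇔-trans ([∘]-cong (flat-⊢ φ)) (O1 ⌜ flat φ ⌝ᴮ (IsL0-⌜⌝ᴮ (flat φ)))
  flat-⊢ (□ a φ) with provable⊎countermodel (toK (flat φ))
  ... | inj₁ (⊢φ , _) =
        MP (taut (x₁ ⇒ₚ (x₁ ⇔ₚ ⊤ₚ)) (atom p₀ ∷ [∘] (□ a φ) ∷ [])) (ON a (MP (⇔-from (flat-⊢ φ)) ⊢φ))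
  ... | inj₂ (M , _ , s , ⊭φ) =
        MP (taut (¬ₚ x₁ ⇒ₚ (x₁ ⇔ₚ ¬ₚ ⊤ₚ)) (atom p₀ ∷ [∘] (□ a φ) ∷ []))
           ([∘]-¬□ a φ (flat φ) (V M s) (flat-⊢ φ) (⊭φ ∘ from (⊨ᴮ-valuation M s (flat φ))))

  [∘]-free : Form → KForm
  [∘]-free (atom p) = katom p
  [∘]-free (¬' φ)   = kneg ([∘]-free φ)
  [∘]-free (φ ∧' ψ) = kand ([∘]-free φ) ([∘]-free ψ)
  [∘]-free (□ a φ)  = kbox a ([∘]-free φ)
  [∘]-free ([∘] φ)  = toK (flat φ)

  [∘]-free-⊢ : ∀ φ → ⊢ (φ ⇔ ⌜ [∘]-free φ ⌝)
  [∘]-free-⊢ (atom p) = ⇔-refl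
  [∘]-free-⊢ (¬' φ)   = ¬-cong ([∘]-free-⊢ φ)
  [∘]-free-⊢ (φ ∧' ψ) = ∧-cong ([∘]-free-⊢ φ) ([∘]-free-⊢ ψ)
  [∘]-free-⊢ (□ a φ)  = □-cong a ([∘]-free-⊢ φ)
  [∘]-free-⊢ ([∘] φ)  = flat-⊢ φ

  [∘]-free-⊨ : ∀ (M : Model) s φ → (M , s ⊨ φ) ⟺ (M , s ⊨ ⌜ [∘]-free φ ⌝)
  [∘]-free-⊨ M s (atom p) = mk⇔ id id
  [∘]-free-⊨ M s (¬' φ)   = ¬-cong-⇔ ([∘]-free-⊨ M s φ)
  [∘]-free-⊨ M s (φ ∧' ψ) = [∘]-free-⊨ M s φ ×-⇔ [∘]-free-⊨ M s ψ
  [∘]-free-⊨ M s (□ a φ)  = mk⇔ (λ □φ t st → to ([∘]-free-⊨ M t φ) (□φ t st))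
                                (λ □φ t st → from ([∘]-free-⊨ M t φ) (□φ t st))
  [∘]-free-⊨ M s ([∘] φ)  = ⟺-sym (⊨ᴮ-valuation M s (flat φ)) ⇔-∘ flat-⊨ φ (V M s)

  enumerable⇒countable : ∀ {X} → Enumerable X → X → CountableNonEmpty X
  enumerable⇒countable (e , e-onto) x₀ =
    fromMaybe x₀ ∘ e , λ x → let n , eₙ = e-onto x in n , cong (fromMaybe x₀) eₙ

  completeness : ∀ φ → Valid φ → ⊢ φ
  completeness φ valid with provable⊎countermodel ([∘]-free φ)
  ... | inj₁ (⊢φ′ , _)         = MP (⇔-from ([∘]-free-⊢ φ)) ⊢φ′
  ... | inj₂ (M , e , s , ⊭φ′) = ⊥-elim (⊭φ′ (to ([∘]-free-⊨ M s φ) (valid M (enumerable⇒countable e s) s)))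

proposition11 : (P : Set) (enc : P → ℕ) (enc-inj : Injective _≡_ _≡_ enc) (p₀ : P) (k : ℕ) →
    let open Logic P (decFromInj enc enc-inj) p₀ (suc k) in
      ∀ (φ : Form) → Valid φ → ⊢ φ
proposition11 P enc enc-inj p₀ k = Completeness.completeness P (decFromInj enc enc-inj) p₀ (suc k)
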